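{- Let $M=\langle W,R,U,D,I\rangle$ be a model based on a frame in $\mathscr F(\mathcal C)$, let $\sigma$ be an assignment, $\iota$ an interpretation, $\mathcal G$ a nested sequent with components named $w,u$, $c\in\{\mathsf f,\mathsf b\}$, and $\mathbf G$ the set of all $\mathbf G(n,k)\in\mathcal C$. If $M,\sigma,\iota\not\Vdash\mathcal G$ and $w\xrightarrow{L}u$ holds in $\mathcal G$ with $L=L_{S(\mathbf G)}(c)$, then $\iota(w)\,\rho(c)\,\iota(u)$.
   Context: Syntax. Terms are variables or constants; formulas (negation normal form) are $P(\vec t)$, $\neg P(\vec t)$, $t=s$, $t\neq s$, and closure under $\lor,\land,\exists x,\forall x,\Diamond,\Box$. Semantics. A frame is $\langle W,R,U,D\rangle$ with $W\neq\emptyset$, $R\subseteq W\times W$, $U\neq\emptyset$ and $D_w\subseteq U$ for each $w$. A model adds $I$ with $I_w(P)\subseteq U^n$ for $n$-ary $P$ and $I_w(a)\in U$ for constants, $wRu\Rightarrow I_w(a)=I_u(a)$. An assignment is $\sigma:\mathrm{Var}\to U$, $I^\sigma_w(x)=\sigma(x)$, $I^\sigma_w(a)=I_w(a)$; satisfaction $M,w,\sigma\Vdash\phi$ is standard with quantifiers ranging over $D_w$ and $\Diamond,\Box$ over $R$-successors. Frame conditions: $\mathbf D$ (seriality); $\mathbf G(n,k)$: $wR^nu$ and $wR^kv$ imply $uRv$ ($R^0$ identity); $\mathbf{ID}$: $wRv\Rightarrow D_w\subseteq D_v$; $\mathbf{DD}$: $wRv\Rightarrow D_v\subseteq D_w$;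 $\mathbf{CD}$: $D_w=U$; $\mathbf{NE}$: $D_w\neq\emptyset$. $\mathcal C$ is a set of such conditions (assumed closed under semantic consequence among these conditions), $\mathscr F(\mathcal C)$ the frames satisfying them. Grammars. Strings over $\{\mathsf f,\mathsf b\}$; a $\Sigma$-system $S$ is a set of productions $c\to s$; one-step derivation $s'cr'\to s'sr'$; $\to^*_S$ reflexive-transitive closure; $L_S(s)=\{t:s\to^*_St\}$. $S(\mathbf G)$ consists of $\mathsf f\to\mathsf b^n\mathsf f^k$ and $\mathsf b\to\mathsf b^k\mathsf f^n$ for each $\mathbf G(n,k)\in\mathbf G$. $\rho(\mathsf f)=R$, $\rho(\mathsf b)=R^{ -1}$. Nested sequents. A flat sequent is $\vec t,\vec\phi$ (multiset of terms, multiset of formulas); a nested sequent $\Gamma,[\mathcal H_1],\dots,[\mathcal H_n]$ is a tree of uniquely named flat sequents (components) with root $\Gamma$ whose children are the roots of the $\mathcal H_i$. In $\mathcal G$, $w\xrightarrow{\mathsf f}u$ and $u\xrightarrow{\mathsf b}w$ hold for each parent $w$ and child $u$; $w\xrightarrow{c_1\cdots c_m}u$ means there are components $w=v_0,\dots,v_m=u$ with $v_{i-1}\xrightarrow{c_i}v_i$ ($w=u$ for the empty string); $w\xrightarrow{L}u$ means $w\xrightarrow{s}u$ for some $s\in L$. Sequent semantics. An interpretation $\iota$ maps component names to worlds. $M,\sigma,\iota\Vdash\mathcal G$ iff: if (1) $\iota(u)R\iota(v)$ for every parent $u$ and child $v$, and (2) $I^\sigma_{\iota(u)}(t)\in D_{\iota(u)}$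 for every term $t$ in the signature of every component $u$, then (3) for some component $v$ with formulas $\vec\phi$, $M,\iota(v),\sigma\Vdash\bigvee\vec\phi$. -}

module Defs where

open import Level using (Level; 0ℓ) renaming (suc to lsuc)
open import Data.Nat using (ℕ; zero; suc; _≟_)
open import Data.Vec using (Vec; map)
open import Data.List using (List; []; _∷_; _++_; replicate)
open import Data.List.Relation.Unary.Any using (Any)
open import Data.List.Relation.Unary.All using (All)
open import Data.List.Relation.Unary.Unique.Propositional using (Unique)
open import Data.List.Membership.Propositional using (_∈_)
open import Data.Product using (Σ; ∃; _×_; _,_)
open import Data.Sum using (_⊎_)
open import Relation.Nullary using (¬_; yes; no)
open import Relation.Binary.PropositionalEquality using (_≡_)
open import Relation.Binary.Construct.Closure.ReflexiveTransitive using (Star)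

Var : Set
Var = ℕ

Const : Set
Const = ℕ

record PSym : Set where
  constructor psym
  field
    name  : ℕ
    arity : ℕ
open PSym public

data Term : Set where
  var : Var → Term
  con : Const → Term

-- formulas in negation normal form
data Formula : Set where
  atom  : (P : PSym) → Vec Term (arity P) → Formula
  natom : (P : PSym) → Vec Term (arity P) → Formula
  eq    : Term → Term → Formula
  neq   : Term → Term → Formula
  _∨′_  : Formula → Formula → Formula
  _∧′_  : Formula → Formula → Formula
  ex    : Var → Formula → Formula
  all   : Var → Formula → Formula
  dia   : Formula → Formula
  box   : Formula → Formula

record Frame : Set₁ where
  field
    W  : Set
    R  : W → W → Set
    U  : Set
    D  : W → U → Set
    w₀ : W                    -- W ≠ ∅
    u₀ : U                    -- U ≠ ∅

RPow : {W : Set} → (W → W → Set) → ℕ → W → W → Set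
RPow R zero    w u = w ≡ u
RPow R (suc n) w u = Σ _ λ v → R w v × RPow R n v u

data Cond : Set where
  Dc  : Cond
  Gc  : ℕ → ℕ → Cond
  IDc : Cond
  DDc : Cond
  CDc : Cond
  NEc : Cond

FrameSat : Frame → Cond → Set
FrameSat F Dc       = ∀ w → Σ W λ v → R w v where open Frame F
FrameSat F (Gc n k) = ∀ w u v → RPow R n w u → RPow R k w v → R u v where open Frame F
FrameSat F IDc      = ∀ w v → R w v → ∀ d → D w d → D v d where open Frame F
FrameSat F DDc      = ∀ w v → R w v → ∀ d → D v d → D w d where open Frame F
FrameSat F CDc      = ∀ w d → D w d where open Frame F
FrameSat F NEc      = ∀ w → Σ U λ d → D w d where open Frame F

CondSet : Set₁
CondSet = Cond → Set

InFrames : CondSet → Frame → Set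
InFrames 𝒞 F = ∀ c → 𝒞 c → FrameSat F c

Closed : CondSet → Set₁
Closed 𝒞 = ∀ c → (∀ (F : Frame) → InFrames 𝒞 F → FrameSat F c) → 𝒞 c

record Model (F : Frame) : Set₁ where
  open Frame F
  field
    IP    : W → (P : PSym) → Vec U (arity P) → Set
    IC    : W → Const → U
    rigid : ∀ w u → R w u → ∀ a → IC w a ≡ IC u a

module _ {F : Frame} (M : Model F) where
  open Frame F
  open Model M

  Assignment : Set
  Assignment = Var → U

  update : Assignment → Var → U → Assignment
  update σ x d y with x ≟ y
  ... | yes _ = d
  ... | no  _ = σ y

  evalT : W → Assignment → Term → U
  evalT w σ (var x) = σ x
  evalT w σ (con a) = IC w a

  Sat : W → Assignment → Formula → Set
  Sat w σ (atom P ts)  = IP w P (map (evalT w σ) ts)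
  Sat w σ (natom P ts) = ¬ IP w P (map (evalT w σ) ts)
  Sat w σ (eq t s)     = evalT w σ t ≡ evalT w σ s
  Sat w σ (neq t s)    = ¬ (evalT w σ t ≡ evalT w σ s)
  Sat w σ (φ ∨′ ψ)     = Sat w σ φ ⊎ Sat w σ ψ
  Sat w σ (φ ∧′ ψ)     = Sat w σ φ × Sat w σ ψ
  Sat w σ (ex x φ)     = Σ U λ d → D w d × Sat w (update σ x d) φ
  Sat w σ (all x φ)    = ∀ d → D w d → Sat w (update σ x d) φ
  Sat w σ (dia φ)      = Σ W λ v → R w v × Sat v σ φ
  Sat w σ (box φ)      = ∀ v → R w v → Sat v σ φ

data Ch : Set where
  f b : Ch

Str : Set
Str = List Ch

data ProdS (𝒞 : CondSet) : Ch → Str → Set where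
  fwd : ∀ {n k} → 𝒞 (Gc n k) → ProdS 𝒞 f (replicate n b ++ replicate k f)
  bwd : ∀ {n k} → 𝒞 (Gc n k) → ProdS 𝒞 b (replicate k b ++ replicate n f)

data Step (𝒞 : CondSet) : Str → Str → Set where
  step : ∀ s′ c s r′ → ProdS 𝒞 c s → Step 𝒞 (s′ ++ c ∷ r′) (s′ ++ s ++ r′)

Lang : CondSet → Str → Str → Set
Lang 𝒞 s t = Star (Step 𝒞) s t

Name : Set
Name = ℕ

-- a component: name, terms (its signature), formulas, children
data NSeq : Set where
  node : Name → List Term → List Formula → List NSeq → NSeq

rootName : NSeq → Name
rootName (node x _ _ _) = x

data SubTree : NSeq → NSeq → Set where
  here  : ∀ {G} → SubTree G G
  there : ∀ {x ts φs Hs H G} → H ∈ Hs → SubTree G H → SubTree G (node x ts φs Hs)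

names : NSeq → List Name
namesL : List NSeq → List Name
names (node x _ _ Hs) = x ∷ namesL Hs
namesL []       = []
namesL (H ∷ Hs) = names H ++ namesL Hs

WellNamed : NSeq → Set
WellNamed G = Unique (names G)

Component : NSeq → Name → List Term → List Formula → Set
Component G w ts φs = Σ NSeq λ H → SubTree H G × Σ (List NSeq) λ Hs → H ≡ node w ts φs Hs

Child : NSeq → Name → Name → Set
Child G w u = Σ (List Term) λ ts → Σ (List Formula) λ φs → Σ (List NSeq) λ Hs →
  SubTree (node w ts φs Hs) G × Any (λ H → rootName H ≡ u) Hs

Edge : NSeq → Ch → Name → Name → Set
Edge G f w u = Child G w u
Edge G b w u = Child G u w

IsComp : NSeq → Name → Set
IsComp G w = Σ (List Term) λ ts → Σ (List Formula) λ φs → Component G w ts φs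

data Path (G : NSeq) : Name → Str → Name → Set where
  nil  : ∀ {w} → Path G w [] w
  cons : ∀ {w v u c s} → Edge G c w v → Path G v s u → Path G w (c ∷ s) u

PathL : NSeq → Name → (Str → Set) → Name → Set
PathL G w L u = Σ Str λ s → L s × Path G w s u

module _ {F : Frame} (M : Model F) where
  open Frame F

  Interp : Set
  Interp = Name → W

  EdgesOK : Interp → NSeq → Set
  EdgesOK ι G = ∀ u v → Child G u v → R (ι u) (ι v)

  TermsOK : Assignment M → Interp → NSeq → Set
  TermsOK σ ι G = ∀ u ts φs → Component G u ts φs →
    All (λ t → D (ι u) (evalT M (ι u) σ t)) ts

  SomeTrue : Assignment M → Interp → NSeq → Set
  SomeTrue σ ι G = Σ Name λ v → Σ (List Term) λ ts → Σ (List Formula) λ φs →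
    Component G v ts φs × Any (Sat M (ι v) σ) φs

  SeqSat : Assignment M → Interp → NSeq → Set
  SeqSat σ ι G = EdgesOK ι G → TermsOK σ ι G → SomeTrue σ ι G

  -- M, σ, ι ⊮ 𝒢, read classically: (1) and (2) hold but (3) fails
  SeqNotSat : Assignment M → Interp → NSeq → Set
  SeqNotSat σ ι G = EdgesOK ι G × TermsOK σ ι G × ¬ SomeTrue σ ι G

ρ : {W : Set} → (W → W → Set) → Ch → W → W → Set
ρ R f w u = R w u
ρ R b w u = R u w

-- Read a string c₁⋯cₘ over {f, b} as the relational composite ρ(c₁);⋯;ρ(cₘ).
-- For a production c → bⁿfᵏ (or bᵏfⁿ) of S(𝐆), a pair related by the right-hand
-- side has a common ancestor v with v Rⁿ x and v Rᵏ y, so G(n,k) gives x ρ(c) y: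
-- every production, hence every derivation step and every derivation, only
-- shrinks the relation. A path w -s-> u in the sequent realises s between ι w
-- and ι u as soon as ι maps parent-child edges to R, which is condition (1)
-- of M, σ, ι ⊮ 𝒢; so s ∈ L(c) yields ι w ρ(c) ι u.
module Submission where

open import Defs
open import Data.List using ([_]; []; _∷_; _++_; replicate)
open import Data.Nat using (ℕ; zero; suc)
open import Data.Product using (Σ; _×_; _,_)
open import Relation.Binary.PropositionalEquality using (_≡_; refl)
open import Relation.Binary.Construct.Closure.ReflexiveTransitive using (ε; _◅_)

module StringRelation {W : Set} (R : W → W → Set) where

  ρ* : Str → W → W → Set
  ρ* []      x y = x ≡ y
  ρ* (c ∷ s) x y = Σ W λ v → ρ R c x v × ρ* s v y

  ρ*-[c]⇒ρ : ∀ c {x y} → ρ* [ c ] x y → ρ R c x y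
  ρ*-[c]⇒ρ c (_ , xy , refl) = xy

  ρ*-++⁻ : ∀ s t {x y} → ρ* (s ++ t) x y → Σ W λ v → ρ* s x v × ρ* t v y
  ρ*-++⁻ []      t xy = _ , refl , xy
  ρ*-++⁻ (c ∷ s) t (v , xv , vy) with ρ*-++⁻ s t vy
  ... | m , vm , my = m , (v , xv , vm) , my

  ρ*-++⁺ : ∀ s t {x v y} → ρ* s x v → ρ* t v y → ρ* (s ++ t) x y
  ρ*-++⁺ []      t refl vy = vy
  ρ*-++⁺ (c ∷ s) t (m , xm , mv) vy = m , xm , ρ*-++⁺ s t mv vy

  RPow-snoc : ∀ n {x y z} → RPow R n x y → R y z → RPow R (suc n) x z
  RPow-snoc zero    refl             yz = _ , yz , refl
  RPow-snoc (suc n) (m , xm , my) yz = m , xm , RPow-snoc n my yz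

  ρ*-fᵏ⇒RPow : ∀ k {x y} → ρ* (replicate k f) x y → RPow R k x y
  ρ*-fᵏ⇒RPow zero    xy            = xy
  ρ*-fᵏ⇒RPow (suc k) (m , xm , my) = m , xm , ρ*-fᵏ⇒RPow k my

  ρ*-bⁿ⇒RPow⁻¹ : ∀ n {x y} → ρ* (replicate n b) x y → RPow R n y x
  ρ*-bⁿ⇒RPow⁻¹ zero    refl          = refl
  ρ*-bⁿ⇒RPow⁻¹ (suc n) (m , mx , my) = RPow-snoc n (ρ*-bⁿ⇒RPow⁻¹ n my) mx

  SatisfiesG : ℕ → ℕ → Set
  SatisfiesG n k = ∀ w u v → RPow R n w u → RPow R k w v → R u v

  module _ (𝒞 : CondSet) (G-sound : ∀ {n k} → 𝒞 (Gc n k) → SatisfiesG n k) where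

    ProdS-sound : ∀ {c s x y} → ProdS 𝒞 c s → ρ* s x y → ρ R c x y
    ProdS-sound (fwd {n} {k} g) xy with ρ*-++⁻ (replicate n b) (replicate k f) xy
    ... | v , xv , vy = G-sound g v _ _ (ρ*-bⁿ⇒RPow⁻¹ n xv) (ρ*-fᵏ⇒RPow k vy)
    ProdS-sound (bwd {n} {k} g) xy with ρ*-++⁻ (replicate k b) (replicate n f) xy
    ... | v , xv , vy = G-sound g v _ _ (ρ*-fᵏ⇒RPow n vy) (ρ*-bⁿ⇒RPow⁻¹ k xv)

    Step-sound : ∀ {s t x y} → Step 𝒞 s t → ρ* t x y → ρ* s x y
    Step-sound (step s′ c s r′ p) xy with ρ*-++⁻ s′ (s ++ r′) xy
    ... | v , xv , vy with ρ*-++⁻ s r′ vy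
    ... | m , vm , my = ρ*-++⁺ s′ (c ∷ r′) xv (m , ProdS-sound p vm , my)

    Lang-sound : ∀ {s t x y} → Lang 𝒞 s t → ρ* t x y → ρ* s x y
    Lang-sound ε            xy = xy
    Lang-sound (st ◅ steps) xy = Step-sound st (Lang-sound steps xy)

open StringRelation

Path⇒ρ* : ∀ {F : Frame} (M : Model F) (ι : Interp M) {G w s u} →
          EdgesOK M ι G → Path G w s u → ρ* (Frame.R F) s (ι w) (ι u)
Path⇒ρ* M ι edges nil                = refl
Path⇒ρ* M ι edges (cons {c = f} e p) = _ , edges _ _ e , Path⇒ρ* M ι edges p
Path⇒ρ* M ι edges (cons {c = b} e p) = _ , edges _ _ e , Path⇒ρ* M ι edges p

mainTheorem16 : (𝒞 : CondSet) → Closed 𝒞 →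
    (F : Frame) → InFrames 𝒞 F → (M : Model F) →
    (σ : Assignment M) → (ι : Interp M) →
    (G : NSeq) → WellNamed G →
    (w u : Name) → IsComp G w → IsComp G u →
    (c : Ch) →
    SeqNotSat M σ ι G →
    PathL G w (Lang 𝒞 [ c ]) u →
    ρ (Frame.R F) c (ι w) (ι u)
mainTheorem16 𝒞 _ F inF M σ ι G _ w u _ _ c (edges , _ , _) (s , c→*s , path) =
  ρ*-[c]⇒ρ R c (Lang-sound R 𝒞 (λ {n} {k} → inF (Gc n k)) c→*s (Path⇒ρ* M ι edges path))
  where open Frame F using (R)
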